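{- Let $L_1$ and $L_2$ be context-free languages. Then $GSA(L_1,L_2)$ is a context-free language.
   Context: For words $w_1,w_2$ and a nonempty word $x$ that is a substring of both, $GSA_x(w_1,w_2)=\{u_1xv_1,u_2xv_2,u_1xv_2,u_2xv_1 : w_1=u_1xv_1,\ w_2=u_2xv_2\}$ over all such factorizations; $GSA(w_1,w_2)=\bigcup_x GSA_x(w_1,w_2)$ over all nonempty common substrings $x$; and $GSA(L_1,L_2)=\bigcup_{w_1\in L_1,w_2\in L_2}GSA(w_1,w_2)$. -}

module Defs where

open import Data.Nat using (ℕ)
open import Data.Fin using (Fin)
open import Data.List using (List; []; _∷_; _++_; map)
open import Data.List.Membership.Propositional using (_∈_)
open import Data.Product using (_×_; _,_; Σ; ∃; ∃-syntax)
open import Data.Sum using (_⊎_; inj₁; inj₂)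
open import Relation.Binary.PropositionalEquality using (_≡_)
open import Relation.Binary.Construct.Closure.ReflexiveTransitive using (Star)
open import Relation.Nullary using (¬_)

Language : Set → Set₁
Language T = List T → Set

-- A context-free grammar over terminal alphabet T, with finitely many
-- nonterminals Fin nN, a start symbol, and a finite list of productions
-- A → α with α a string of nonterminals (inj₁) and terminals (inj₂).
record CFG (T : Set) : Set where
  field
    nN    : ℕ
    start : Fin nN
    rules : List (Fin nN × List (Fin nN ⊎ T))

module _ {T : Set} (G : CFG T) where
  open CFG G

  Sentential : Set
  Sentential = List (Fin nN ⊎ T)

  data _⇒_ : Sentential → Sentential → Set where
    step : ∀ (u v : Sentential) (A : Fin nN) (α : Sentential) →
           (A , α) ∈ rules →
           _⇒_ (u ++ (inj₁ A ∷ v)) (u ++ (α ++ v))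

  _⇒*_ : Sentential → Sentential → Set
  _⇒*_ = Star _⇒_

  LangOf : Language T
  LangOf w = (inj₁ start ∷ []) ⇒* map inj₂ w

IsContextFree : {T : Set} → Language T → Set
IsContextFree {T} L = Σ (CFG T) λ G → ∀ w → (L w → LangOf G w) × (LangOf G w → L w)

GSAₓ : {T : Set} → List T → List T → List T → Language T
GSAₓ x w₁ w₂ w =
  ∃[ u₁ ] ∃[ v₁ ] ∃[ u₂ ] ∃[ v₂ ]
    (w₁ ≡ u₁ ++ x ++ v₁) × (w₂ ≡ u₂ ++ x ++ v₂) ×
    ((w ≡ u₁ ++ x ++ v₁) ⊎ (w ≡ u₂ ++ x ++ v₂) ⊎
     (w ≡ u₁ ++ x ++ v₂) ⊎ (w ≡ u₂ ++ x ++ v₁))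

-- GSA(w₁,w₂): union over all nonempty x (common substrings; the
-- factorizations in GSAₓ force x to be a common substring)
GSAw : {T : Set} → List T → List T → Language T
GSAw w₁ w₂ w = ∃[ x ] (¬ x ≡ []) × GSAₓ x w₁ w₂ w

GSA : {T : Set} → Language T → Language T → Language T
GSA L₁ L₂ w = ∃[ w₁ ] ∃[ w₂ ] L₁ w₁ × L₂ w₂ × GSAw w₁ w₂ w

module Submission where

-- A nonempty common factor x = a x′ may always be shortened to its
-- first letter a, so w ∈ GSA(L₁,L₂) iff for some letter a, w recombines a
-- word u₁ a v₁ ∈ L₁ and a word u₂ a v₂ ∈ L₂ at an occurrence of a.  Each of
-- the four recombinations is a concatenation of two "marked images"
--   { h(u) m h′(v) : u a v ∈ L }
-- where the homomorphisms h, h′ either keep or erase every letter and m is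
-- a or ε.  So GSA(L₁,L₂) is a finite union of concatenations of marked
-- images, and it suffices to show that context-free languages are closed
-- under marked images, concatenation, binary and finite unions.

open import Defs
open import Data.Bool using (Bool; true; false)
open import Data.Nat using (ℕ; zero; suc; _+_; _*_)
open import Data.Fin using (Fin; zero; suc)
open import Data.Fin.Properties using (+↔⊎; *↔×; _≟_)
open import Data.List using (List; []; _∷_; _++_; map; concatMap; [_])
open import Data.List.Properties using (∷-injective; ++-assoc; ++-identityʳ; map-++; concatMap-++; concatMap-pure)
open import Data.List.Membership.Propositional using (_∈_; find; lose)
open import Data.List.Membership.Propositional.Properties
  using (∈-map⁺; ∈-map⁻; ∈-++⁺ˡ; ∈-++⁺ʳ; ∈-++⁻; ∈-concatMap⁺; ∈-concatMap⁻)
open import Data.List.Relation.Unary.Any using (here; there)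
open import Data.Product using (_×_; _,_; proj₁; proj₂; ∃; ∃₂)
open import Data.Product.Function.NonDependent.Propositional using (_×-↣_)
open import Data.Sum using (_⊎_; inj₁; inj₂; map₁; [_,_]′)
open import Data.Sum.Function.Propositional using (_⊎-↣_)
open import Data.Unit using (⊤; tt)
open import Data.Empty using (⊥; ⊥-elim)
open import Function using (_∘_)
open import Function.Bundles using (_↣_; _⇔_; mk↣; mk⇔; Injection; Equivalence)
open import Function.Construct.Identity using (↣-id)
open import Function.Construct.Composition using (_↣-∘_)
open import Function.Construct.Symmetry using (↔-sym)
open import Function.Properties.Inverse using (↔⇒↣)
open import Relation.Binary.Definitions using (DecidableEquality)
open import Relation.Binary.PropositionalEquality hiding ([_])
open import Relation.Binary.Construct.Closure.ReflexiveTransitive using (ε; _◅_; _◅◅_; gmap)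
open import Relation.Nullary using (yes; no)

_≐_ : {T : Set} → Language T → Language T → Set
L ≐ L′ = ∀ w → (L w → L′ w) × (L′ w → L w)

≐-sym : {T : Set} {L L′ : Language T} → L ≐ L′ → L′ ≐ L
≐-sym e w = proj₂ (e w) , proj₁ (e w)

≐-trans : {T : Set} {L L′ L″ : Language T} → L ≐ L′ → L′ ≐ L″ → L ≐ L″
≐-trans e e′ w = proj₁ (e′ w) ∘ proj₁ (e w) , proj₂ (e w) ∘ proj₂ (e′ w)

IsCF-resp : {T : Set} {L L′ : Language T} → L ≐ L′ → IsContextFree L → IsContextFree L′
IsCF-resp e (G , L≐G) = G , ≐-trans (≐-sym e) L≐G

∅ : {T : Set} → Language T
∅ _ = ⊥

_∪_ : {T : Set} → Language T → Language T → Language T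
(L ∪ L′) w = L w ⊎ L′ w

_·_ : {T : Set} → Language T → Language T → Language T
(L · L′) w = ∃₂ λ u v → w ≡ u ++ v × L u × L′ v

MarkedImage : {T : Set} → T → (T → List T) → List T → (T → List T) → Language T → Language T
MarkedImage a hˡ m hʳ L w =
  ∃₂ λ u v → L (u ++ a ∷ v) × w ≡ concatMap hˡ u ++ m ++ concatMap hʳ v

-- Forest I α w says that the sentential form α yields
-- w when every nonterminal A is expanded to a word of the language I A.
data Forest {N T : Set} (I : N → List T → Set) : List (N ⊎ T) → List T → Set where
  []  : Forest I [] []
  tm  : ∀ t {α w} → Forest I α w → Forest I (inj₂ t ∷ α) (t ∷ w)
  nt  : ∀ {A α u w} → I A u → Forest I α w → Forest I (inj₁ A ∷ α) (u ++ w)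

data Tree {N T : Set} (R : N → List (N ⊎ T) → Set) : N → List T → Set where
  node : ∀ {A β w} → R A β → Forest (Tree R) β w → Tree R A w

module _ {N T : Set} {R : N → List (N ⊎ T) → Set} (I : N → List T → Set)
         (closed : ∀ {A β w} → R A β → Forest I β w → I A w) where

  tree-ind : ∀ {A w} → Tree R A w → I A w
  forest-ind : ∀ {α w} → Forest (Tree R) α w → Forest I α w

  tree-ind (node r f) = closed r (forest-ind f)
  forest-ind [] = []
  forest-ind (tm t f) = tm t (forest-ind f)
  forest-ind (nt x f) = nt (tree-ind x) (forest-ind f)

module _ {N T : Set} {I : N → List T → Set} where

  forest-++ : ∀ {α β u v} → Forest I α u → Forest I β v → Forest I (α ++ β) (u ++ v)
  forest-++ [] g = g
  forest-++ (tm t f) g = tm t (forest-++ f g)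
  forest-++ {v = v} (nt {u = x} {w = y} i f) g =
    subst (Forest I _) (sym (++-assoc x y v)) (nt i (forest-++ f g))

  forest-split : ∀ α {β w} → Forest I (α ++ β) w →
                 ∃₂ λ u v → w ≡ u ++ v × Forest I α u × Forest I β v
  forest-split [] f = [] , _ , refl , [] , f
  forest-split (inj₂ t ∷ α) (tm .t f) with forest-split α f
  ... | u , v , refl , f₁ , f₂ = t ∷ u , v , refl , tm t f₁ , f₂
  forest-split (inj₁ A ∷ α) (nt {u = x} i f) with forest-split α f
  ... | u , v , refl , f₁ , f₂ = x ++ u , v , sym (++-assoc x u v) , nt i f₁ , f₂

  terminals : ∀ w → Forest I (map inj₂ w) w
  terminals [] = []
  terminals (t ∷ w) = tm t (terminals w)

  terminals⁻ : ∀ w {w′} → Forest I (map inj₂ w) w′ → w′ ≡ w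
  terminals⁻ [] [] = refl
  terminals⁻ (t ∷ w) (tm .t f) = cong (t ∷_) (terminals⁻ w f)

  single : ∀ {A w} → I A w → Forest I (inj₁ A ∷ []) w
  single {w = w} i = subst (Forest I _) (++-identityʳ w) (nt i [])

  single⁻ : ∀ {A w} → Forest I (inj₁ A ∷ []) w → I A w
  single⁻ (nt {u = u} i []) = subst (I _) (sym (++-identityʳ u)) i

rename : {N N′ T : Set} → (N → N′) → List (N ⊎ T) → List (N′ ⊎ T)
rename ι = map (map₁ ι)

module _ {N N′ T : Set} {I : N → List T → Set} {J : N′ → List T → Set} (ι : N → N′) where

  forest-map : (∀ {A w} → I A w → J (ι A) w) → ∀ {α w} → Forest I α w → Forest J (rename ι α) w
  forest-map φ [] = []
  forest-map φ (tm t f) = tm t (forest-map φ f)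
  forest-map φ (nt i f) = nt (φ i) (forest-map φ f)

  forest-comap : (∀ {A w} → J (ι A) w → I A w) → ∀ α {w} → Forest J (rename ι α) w → Forest I α w
  forest-comap φ [] [] = []
  forest-comap φ (inj₂ t ∷ α) (tm .t f) = tm t (forest-comap φ α f)
  forest-comap φ (inj₁ A ∷ α) (nt j f) = nt (φ j) (forest-comap φ α f)

module Renaming {N N′ T : Set} {R : N → List (N ⊎ T) → Set} {R′ : N′ → List (N′ ⊎ T) → Set}
  (ι : N → N′)
  (fwd : ∀ {A β} → R A β → R′ (ι A) (rename ι β))
  (bwd : ∀ {A β′} → R′ (ι A) β′ → ∃ λ β → R A β × β′ ≡ rename ι β) where

  tree-rename : ∀ {A w} → Tree R A w → Tree R′ (ι A) w
  tree-rename = tree-ind (λ A → Tree R′ (ι A)) λ r f → node (fwd r) (forest-map ι (λ t → t) f)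

  tree-unrename : ∀ {A w} → Tree R′ (ι A) w → Tree R A w
  tree-unrename t = tree-ind Preimage closed t refl
    where
    Preimage : N′ → List T → Set
    Preimage B w = ∀ {A} → ι A ≡ B → Tree R A w

    closed : ∀ {B β′ w} → R′ B β′ → Forest Preimage β′ w → Preimage B w
    closed r f refl with bwd r
    ... | β , r₀ , refl = node r₀ (forest-comap ι (λ p → p refl) β f)

module Derivations {T : Set} (G : CFG T) where
  open CFG G

  Production : Fin nN → Sentential G → Set
  Production A β = (A , β) ∈ rules

  _⟶_ _⟶*_ : Sentential G → Sentential G → Set
  _⟶_ = _⇒_ G
  _⟶*_ = _⇒*_ G

  ⟶-prefix : ∀ x {α β} → α ⟶ β → (x ++ α) ⟶ (x ++ β)
  ⟶-prefix x (step u v A α p) =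
    subst₂ _⟶_ (++-assoc x u _) (++-assoc x u _) (step (x ++ u) v A α p)

  ⟶-suffix : ∀ y {α β} → α ⟶ β → (α ++ y) ⟶ (β ++ y)
  ⟶-suffix y (step u v A α p) =
    subst₂ _⟶_ (sym (++-assoc u (inj₁ A ∷ v) y))
      (trans (cong (u ++_) (sym (++-assoc α v y))) (sym (++-assoc u (α ++ v) y)))
      (step u (v ++ y) A α p)

  Derives : Fin nN → List T → Set
  Derives A w = (inj₁ A ∷ []) ⟶* map inj₂ w

  forest-derives : ∀ {α w} → Forest Derives α w → α ⟶* map inj₂ w
  forest-derives [] = ε
  forest-derives (tm t f) = gmap (inj₂ t ∷_) (⟶-prefix (inj₂ t ∷ [])) (forest-derives f)
  forest-derives {inj₁ A ∷ α} (nt {u = u} {w = w} d f) =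
    gmap (_++ α) (⟶-suffix α) d ◅◅
    subst (λ γ → (map inj₂ u ++ α) ⟶* γ) (sym (map-++ inj₂ u w))
      (gmap (map inj₂ u ++_) (⟶-prefix (map inj₂ u)) (forest-derives f))

  tree-derives : ∀ {A w} → Tree Production A w → Derives A w
  tree-derives = tree-ind Derives λ {A} {β} r f →
    step [] [] A β r ◅ subst (λ γ → γ ⟶* map inj₂ _) (sym (++-identityʳ β)) (forest-derives f)

  unstep : ∀ {α β w} → α ⟶ β → Forest (Tree Production) β w → Forest (Tree Production) α w
  unstep (step u v A γ p) f with forest-split u f
  ... | _ , _ , refl , f₁ , f₂ with forest-split γ f₂
  ... | _ , _ , refl , g₁ , g₂ = forest-++ f₁ (nt (node p g₁) g₂)

  derives-forest : ∀ {α w} → α ⟶* map inj₂ w → Forest (Tree Production) α w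
  derives-forest {w = w} ε = terminals w
  derives-forest (s ◅ ss) = unstep s (derives-forest ss)

  language-trees : LangOf G ≐ Tree Production start
  language-trees w = single⁻ ∘ derives-forest , tree-derives

Finite : Set → Set
Finite A = ∃ λ n → A ↣ Fin n

finite-⊤ : Finite ⊤
finite-⊤ = 1 , mk↣ {to = λ _ → zero} λ _ → refl

finite-⊎ : {A B : Set} → Finite A → Finite B → Finite (A ⊎ B)
finite-⊎ (m , f) (n , g) = m + n , ↔⇒↣ (↔-sym +↔⊎) ↣-∘ (f ⊎-↣ g)

finite-× : {A B : Set} → Finite A → Finite B → Finite (A × B)
finite-× (m , f) (n , g) = m * n , ↔⇒↣ (↔-sym *↔×) ↣-∘ (f ×-↣ g)

-- A grammar with an arbitrary finite type of nonterminals and a rule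
-- relation enumerated by a finite list.  This is the form in which the
-- closure constructions below are most naturally stated.
record Grammar (T : Set) : Set₁ where
  field
    N      : Set
    finite : Finite N
    start  : N
    Rule   : N → List (N ⊎ T) → Set
    rules  : List (N × List (N ⊎ T))
    listed : ∀ {A β} → Rule A β ⇔ ((A , β) ∈ rules)

  language : Language T
  language = Tree Rule start

open Grammar using (language)

cfg-grammar : {T : Set} → CFG T → Grammar T
cfg-grammar G = record
  { N = Fin nN ; finite = nN , ↣-id _ ; start = start
  ; Rule = Derivations.Production G ; rules = rules ; listed = mk⇔ (λ p → p) (λ p → p) }
  where open CFG G

module Encoding {T : Set} (g : Grammar T) where
  open Grammar g hiding (language)
  open Injection (proj₂ finite) using (injective) renaming (to to encode)

  encodeRule : N × List (N ⊎ T) → Fin (proj₁ finite) × List (Fin (proj₁ finite) ⊎ T)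
  encodeRule (A , β) = encode A , rename encode β

  cfg : CFG T
  cfg = record { nN = proj₁ finite ; start = encode start ; rules = map encodeRule rules }

  cfg-language : language g ≐ LangOf cfg
  cfg-language = ≐-trans (λ w → tree-rename , tree-unrename) (≐-sym (Derivations.language-trees cfg))
    where
    bwd : ∀ {A β′} → Derivations.Production cfg (encode A) β′ →
          ∃ λ β → Rule A β × β′ ≡ rename encode β
    bwd p with ∈-map⁻ encodeRule p
    ... | (B , β) , q , e with injective (cong proj₁ e)
    ... | refl = β , Equivalence.from listed q , cong proj₂ e

    open Renaming {R = Rule} {R′ = Derivations.Production cfg} encode (λ r → ∈-map⁺ encodeRule (Equivalence.to listed r)) bwd

context-free : {T : Set} {L : Language T} (g : Grammar T) → L ≐ language g → IsContextFree L
context-free g e = Encoding.cfg g , ≐-trans e (Encoding.cfg-language g)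

grammar-of : {T : Set} {L : Language T} → IsContextFree L → ∃ λ (g : Grammar T) → L ≐ language g
grammar-of (G , e) = cfg-grammar G , ≐-trans e (Derivations.language-trees G)

∅-CF : {T : Set} → IsContextFree {T} ∅
∅-CF = context-free empty λ w → (λ ()) , λ { (node () _) }
  where
  empty : Grammar _
  empty = record { N = ⊤ ; finite = finite-⊤ ; start = tt ; Rule = λ _ _ → ⊥
                 ; rules = [] ; listed = mk⇔ (λ ()) (λ ()) }

-- Joining two grammars under a fresh start symbol whose bodies are the
-- given root forms over the nonterminals of both.  Union and concatenation are instances.
module Join {T : Set} (g₁ g₂ : Grammar T) where
  open Grammar hiding (language)

  Old : Set
  Old = N g₁ ⊎ N g₂

  OldTree : Old → List T → Set
  OldTree (inj₁ A) = Tree (Rule g₁) A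
  OldTree (inj₂ A) = Tree (Rule g₂) A

  module _ (roots : List (List (Old ⊎ T))) where

    data JRule : ⊤ ⊎ Old → List ((⊤ ⊎ Old) ⊎ T) → Set where
      root  : ∀ {β} → β ∈ roots → JRule (inj₁ tt) (rename inj₂ β)
      left  : ∀ {A β} → Rule g₁ A β → JRule (inj₂ (inj₁ A)) (rename (inj₂ ∘ inj₁) β)
      right : ∀ {A β} → Rule g₂ A β → JRule (inj₂ (inj₂ A)) (rename (inj₂ ∘ inj₂) β)

    rootRule : List (Old ⊎ T) → (⊤ ⊎ Old) × List ((⊤ ⊎ Old) ⊎ T)
    rootRule β = inj₁ tt , rename inj₂ β

    leftRule : N g₁ × List (N g₁ ⊎ T) → (⊤ ⊎ Old) × List ((⊤ ⊎ Old) ⊎ T)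
    leftRule (A , β) = inj₂ (inj₁ A) , rename (inj₂ ∘ inj₁) β

    rightRule : N g₂ × List (N g₂ ⊎ T) → (⊤ ⊎ Old) × List ((⊤ ⊎ Old) ⊎ T)
    rightRule (A , β) = inj₂ (inj₂ A) , rename (inj₂ ∘ inj₂) β

    joinRules : List ((⊤ ⊎ Old) × List ((⊤ ⊎ Old) ⊎ T))
    joinRules = map rootRule roots ++ map leftRule (rules g₁) ++ map rightRule (rules g₂)

    listed-to : ∀ {A β} → JRule A β → (A , β) ∈ joinRules
    listed-to (root p) = ∈-++⁺ˡ (∈-map⁺ rootRule p)
    listed-to (left r) =
      ∈-++⁺ʳ (map rootRule roots) (∈-++⁺ˡ (∈-map⁺ leftRule (Equivalence.to (listed g₁) r)))
    listed-to (right r) =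
      ∈-++⁺ʳ (map rootRule roots) (∈-++⁺ʳ (map leftRule (rules g₁))
        (∈-map⁺ rightRule (Equivalence.to (listed g₂) r)))

    listed-from : ∀ {A β} → (A , β) ∈ joinRules → JRule A β
    listed-from p with ∈-++⁻ (map rootRule roots) p
    ... | inj₁ q with ∈-map⁻ rootRule q
    ...   | _ , q′ , refl = root q′
    listed-from p | inj₂ q with ∈-++⁻ (map leftRule (rules g₁)) q
    ... | inj₁ q′ with ∈-map⁻ leftRule q′
    ...   | _ , q″ , refl = left (Equivalence.from (listed g₁) q″)
    listed-from p | inj₂ q | inj₂ q′ with ∈-map⁻ rightRule q′
    ...   | _ , q″ , refl = right (Equivalence.from (listed g₂) q″)

    joined : Grammar T
    joined = record
      { N = ⊤ ⊎ Old ; finite = finite-⊎ finite-⊤ (finite-⊎ (finite g₁) (finite g₂))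
      ; start = inj₁ tt ; Rule = JRule ; rules = joinRules ; listed = mk⇔ listed-to listed-from }

    unleft : ∀ {A β′} → JRule (inj₂ (inj₁ A)) β′ → ∃ λ β → Rule g₁ A β × β′ ≡ rename (inj₂ ∘ inj₁) β
    unleft (left r) = _ , r , refl

    unright : ∀ {A β′} → JRule (inj₂ (inj₂ A)) β′ → ∃ λ β → Rule g₂ A β × β′ ≡ rename (inj₂ ∘ inj₂) β
    unright (right r) = _ , r , refl

    module R₁ = Renaming {R = Rule g₁} {R′ = JRule} (inj₂ ∘ inj₁) left unleft
    module R₂ = Renaming {R = Rule g₂} {R′ = JRule} (inj₂ ∘ inj₂) right unright

    old→joined : ∀ {X w} → OldTree X w → Tree JRule (inj₂ X) w
    old→joined {inj₁ _} = R₁.tree-rename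
    old→joined {inj₂ _} = R₂.tree-rename

    joined→old : ∀ {X w} → Tree JRule (inj₂ X) w → OldTree X w
    joined→old {inj₁ _} = R₁.tree-unrename
    joined→old {inj₂ _} = R₂.tree-unrename

    joined-language : language joined ≐ λ w → ∃ λ β → β ∈ roots × Forest OldTree β w
    joined-language w =
      (λ { (node (root {β} p) f) → β , p , forest-comap inj₂ joined→old β f }) ,
      (λ { (β , p , f) → node (root p) (forest-map inj₂ old→joined f) })

∪-CF : {T : Set} {L₁ L₂ : Language T} → IsContextFree L₁ → IsContextFree L₂ → IsContextFree (L₁ ∪ L₂)
∪-CF {L₁ = L₁} {L₂} cf₁ cf₂ with grammar-of cf₁ | grammar-of cf₂
... | g₁ , e₁ | g₂ , e₂ = context-free (joined roots) (λ w → to w , from w)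
  where
  open Join g₁ g₂
  roots = (inj₁ (inj₁ (Grammar.start g₁)) ∷ []) ∷ (inj₁ (inj₂ (Grammar.start g₂)) ∷ []) ∷ []

  to : ∀ w → (L₁ ∪ L₂) w → language (joined roots) w
  to w (inj₁ l) = proj₂ (joined-language roots w) (_ , here refl , single (proj₁ (e₁ w) l))
  to w (inj₂ l) = proj₂ (joined-language roots w) (_ , there (here refl) , single (proj₁ (e₂ w) l))

  from : ∀ w → language (joined roots) w → (L₁ ∪ L₂) w
  from w t with proj₁ (joined-language roots w) t
  ... | _ , here refl , f = inj₁ (proj₂ (e₁ w) (single⁻ f))
  ... | _ , there (here refl) , f = inj₂ (proj₂ (e₂ w) (single⁻ f))

·-CF : {T : Set} {L₁ L₂ : Language T} → IsContextFree L₁ → IsContextFree L₂ → IsContextFree (L₁ · L₂)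
·-CF {L₁ = L₁} {L₂} cf₁ cf₂ with grammar-of cf₁ | grammar-of cf₂
... | g₁ , e₁ | g₂ , e₂ = context-free (joined roots) (λ w → to w , from w)
  where
  open Join g₁ g₂
  S₁ S₂ : Old ⊎ _
  S₁ = inj₁ (inj₁ (Grammar.start g₁))
  S₂ = inj₁ (inj₂ (Grammar.start g₂))
  roots = (S₁ ∷ S₂ ∷ []) ∷ []

  to : ∀ w → (L₁ · L₂) w → language (joined roots) w
  to w (u , v , refl , l₁ , l₂) = proj₂ (joined-language roots w)
    (_ , here refl , forest-++ (single (proj₁ (e₁ u) l₁)) (single (proj₁ (e₂ v) l₂)))

  from : ∀ w → language (joined roots) w → (L₁ · L₂) w
  from w t with proj₁ (joined-language roots w) t
  ... | _ , here refl , f with forest-split (S₁ ∷ []) f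
  ...   | u , v , refl , f₁ , f₂ = u , v , refl , proj₂ (e₁ u) (single⁻ f₁) , proj₂ (e₂ v) (single⁻ f₂)

⋃-CF : {T : Set} (n : ℕ) (F : Fin n → Language T) →
       (∀ i → IsContextFree (F i)) → IsContextFree (λ w → ∃ λ i → F i w)
⋃-CF zero F cf = IsCF-resp (λ w → (λ ()) , λ ()) ∅-CF
⋃-CF (suc n) F cf = IsCF-resp split (∪-CF (cf zero) (⋃-CF n (F ∘ suc) (cf ∘ suc)))
  where
  split : (F zero ∪ (λ w → ∃ λ i → F (suc i) w)) ≐ (λ w → ∃ λ i → F i w)
  split w = (λ { (inj₁ x) → zero , x ; (inj₂ (i , x)) → suc i , x })
          , (λ { (zero , x) → inj₁ x ; (suc i , x) → inj₂ (i , x) })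

∈-concatMap⁺′ : {A B : Set} (f : A → List B) {x : A} {xs : List A} {y : B} →
                x ∈ xs → y ∈ f x → y ∈ concatMap f xs
∈-concatMap⁺′ f x∈ y∈ = ∈-concatMap⁺ f (lose x∈ y∈)

∈-concatMap⁻′ : {A B : Set} (f : A → List B) (xs : List A) {y : B} →
                y ∈ concatMap f xs → ∃ λ x → x ∈ xs × y ∈ f x
∈-concatMap⁻′ f xs y∈ = find (∈-concatMap⁻ f y∈)

splits : {A : Set} → List A → List (List A × A × List A)
splits [] = []
splits (x ∷ xs) = ([] , x , xs) ∷ map (λ { (p , y , q) → x ∷ p , y , q }) (splits xs)

splits⁺ : {A : Set} (pre : List A) (x : A) (post : List A) → (pre , x , post) ∈ splits (pre ++ x ∷ post)
splits⁺ [] x post = here refl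
splits⁺ (y ∷ pre) x post = there (∈-map⁺ _ (splits⁺ pre x post))

splits⁻ : {A : Set} (xs : List A) {pre : List A} {x : A} {post : List A} →
          (pre , x , post) ∈ splits xs → xs ≡ pre ++ x ∷ post
splits⁻ (y ∷ xs) (here refl) = refl
splits⁻ (y ∷ xs) (there p) with ∈-map⁻ _ p
... | _ , q , refl = cong (y ∷_) (splits⁻ xs q)

split-at-letter : {A : Set} (z₁ : List A) {z₂ : List A} (u : List A) {a : A} {v : List A} →
  z₁ ++ z₂ ≡ u ++ a ∷ v →
  (∃ λ v₁ → z₁ ≡ u ++ a ∷ v₁ × v ≡ v₁ ++ z₂) ⊎ (∃ λ u₂ → u ≡ z₁ ++ u₂ × z₂ ≡ u₂ ++ a ∷ v)
split-at-letter [] u e = inj₂ (u , refl , e)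
split-at-letter (x ∷ z₁) [] refl = inj₁ (z₁ , refl , refl)
split-at-letter (x ∷ z₁) (y ∷ u) e with ∷-injective e
... | refl , e′ with split-at-letter z₁ u e′
... | inj₁ (v₁ , e₁ , e₂) = inj₁ (v₁ , cong (x ∷_) e₁ , e₂)
... | inj₂ (u₂ , e₁ , e₂) = inj₂ (u₂ , cong (x ∷_) e₁ , e₂)

regroup : {A : Set} (x y z v q : List A) → x ++ ((y ++ z ++ v) ++ q) ≡ (x ++ y) ++ z ++ (v ++ q)
regroup x y z v q = begin
  x ++ ((y ++ z ++ v) ++ q)  ≡⟨ cong (x ++_) (++-assoc y (z ++ v) q) ⟩
  x ++ (y ++ (z ++ v) ++ q)  ≡⟨ cong (λ r → x ++ (y ++ r)) (++-assoc z v q) ⟩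
  x ++ (y ++ z ++ (v ++ q))  ≡⟨ sym (++-assoc x y _) ⟩
  (x ++ y) ++ z ++ (v ++ q)  ∎
  where open ≡-Reasoning

data Side : Set where
  left right : Side

finite-Side : Finite Side
finite-Side = 2 , mk↣ {to = code} injective
  where
  code : Side → Fin 2
  code left = zero
  code right = suc zero

  injective : ∀ {x y} → code x ≡ code y → x ≡ y
  injective {left} {left} _ = refl
  injective {right} {right} _ = refl
  injective {left} {right} ()
  injective {right} {left} ()

-- Each nonterminal A of g has three copies:
-- side left A and side right A derive the images under hˡ and hʳ of the
-- words A derives, while focus A derives hˡ(u) m hʳ(v) for each u a v
-- that A derives, by following the path from A down to the marked a.
module Marking {T : Set} (_≟ᵀ_ : DecidableEquality T) (g : Grammar T)
               (a : T) (hˡ : T → List T) (m : List T) (hʳ : T → List T) where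
  open Grammar g hiding (language)

  h : Side → T → List T
  h left = hˡ
  h right = hʳ

  Node : Set
  Node = (Side × N) ⊎ N

  pattern side s A = inj₁ (s , A)
  pattern focus A = inj₂ A

  liftSymbol : Side → N ⊎ T → List (Node ⊎ T)
  liftSymbol s (inj₁ B) = inj₁ (side s B) ∷ []
  liftSymbol s (inj₂ t) = map inj₂ (h s t)

  lift : Side → List (N ⊎ T) → List (Node ⊎ T)
  lift s = concatMap (liftSymbol s)

  data Focus : N ⊎ T → List (Node ⊎ T) → Set where
    descend : ∀ B → Focus (inj₁ B) (inj₁ (focus B) ∷ [])
    hit     : Focus (inj₂ a) (map inj₂ m)

  data MRule : Node → List (Node ⊎ T) → Set where
    unmarked : ∀ s {A β} → Rule A β → MRule (side s A) (lift s β)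
    marked   : ∀ {A} pre {X} post {φ} → Focus X φ → Rule A (pre ++ X ∷ post) →
               MRule (focus A) (lift left pre ++ φ ++ lift right post)

  focusBodies : N ⊎ T → List (List (Node ⊎ T))
  focusBodies (inj₁ B) = (inj₁ (focus B) ∷ []) ∷ []
  focusBodies (inj₂ t) with t ≟ᵀ a
  ... | yes _ = map inj₂ m ∷ []
  ... | no _ = []

  focusBodies-complete : ∀ {X φ} → Focus X φ → φ ∈ focusBodies X
  focusBodies-complete (descend B) = here refl
  focusBodies-complete hit with a ≟ᵀ a
  ... | yes _ = here refl
  ... | no a≢a = ⊥-elim (a≢a refl)

  focusBodies-sound : ∀ X {φ} → φ ∈ focusBodies X → Focus X φ
  focusBodies-sound (inj₁ B) (here refl) = descend B
  focusBodies-sound (inj₂ t) p with t ≟ᵀ a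
  focusBodies-sound (inj₂ t) (here refl) | yes refl = hit
  focusBodies-sound (inj₂ t) () | no _

  MarkedRule : Set
  MarkedRule = Node × List (Node ⊎ T)

  focusRules : N → List (N ⊎ T) × (N ⊎ T) × List (N ⊎ T) → List MarkedRule
  focusRules A (pre , X , post) =
    map (λ φ → focus A , lift left pre ++ φ ++ lift right post) (focusBodies X)

  rulesFrom : N × List (N ⊎ T) → List MarkedRule
  rulesFrom (A , β) =
    (side left A , lift left β) ∷ (side right A , lift right β) ∷ concatMap (focusRules A) (splits β)

  markedRules : List MarkedRule
  markedRules = concatMap rulesFrom rules

  listed-to : ∀ {A β} → MRule A β → (A , β) ∈ markedRules
  listed-to (unmarked left r) = ∈-concatMap⁺′ rulesFrom (Equivalence.to listed r) (here refl)
  listed-to (unmarked right r) = ∈-concatMap⁺′ rulesFrom (Equivalence.to listed r) (there (here refl))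
  listed-to (marked {A} pre {X} post fc r) =
    ∈-concatMap⁺′ rulesFrom (Equivalence.to listed r) (there (there
      (∈-concatMap⁺′ (focusRules A) (splits⁺ pre X post) (∈-map⁺ _ (focusBodies-complete fc)))))

  listed-from : ∀ {A β} → (A , β) ∈ markedRules → MRule A β
  listed-from p with ∈-concatMap⁻′ rulesFrom rules p
  ... | _ , q , here refl = unmarked left (Equivalence.from listed q)
  ... | _ , q , there (here refl) = unmarked right (Equivalence.from listed q)
  ... | (A , β) , q , there (there p′) with ∈-concatMap⁻′ (focusRules A) (splits β) p′
  ...   | (pre , X , post) , s , p″ with ∈-map⁻ _ p″
  ...     | _ , φ∈ , refl =
    marked pre post (focusBodies-sound X φ∈) (subst (Rule A) (splits⁻ β s) (Equivalence.from listed q))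

  image-regroup : ∀ p u v q →
    concatMap hˡ p ++ ((concatMap hˡ u ++ m ++ concatMap hʳ v) ++ concatMap hʳ q) ≡
    concatMap hˡ (p ++ u) ++ m ++ concatMap hʳ (v ++ q)
  image-regroup p u v q =
    trans (regroup (concatMap hˡ p) (concatMap hˡ u) m (concatMap hʳ v) (concatMap hʳ q))
          (sym (cong₂ (λ x y → x ++ m ++ y) (concatMap-++ hˡ p u) (concatMap-++ hʳ v q)))

  image-prepend : ∀ p u v →
    concatMap hˡ p ++ (concatMap hˡ u ++ m ++ concatMap hʳ v) ≡ concatMap hˡ (p ++ u) ++ m ++ concatMap hʳ v
  image-prepend p u v =
    trans (sym (++-assoc (concatMap hˡ p) _ _)) (cong (_++ m ++ concatMap hʳ v) (sym (concatMap-++ hˡ p u)))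

  Meaning : Node → List T → Set
  Meaning (side s A) w = ∃ λ w₀ → Tree Rule A w₀ × w ≡ concatMap (h s) w₀
  Meaning (focus A) w = MarkedImage a hˡ m hʳ (Tree Rule A) w

  lift-sound : ∀ s β {w} → Forest Meaning (lift s β) w →
               ∃ λ w₀ → Forest (Tree Rule) β w₀ × w ≡ concatMap (h s) w₀
  lift-sound s [] [] = [] , [] , refl
  lift-sound s (inj₁ B ∷ β) (nt (w₀ , t , refl) f) with lift-sound s β f
  ... | w₁ , f₁ , refl = w₀ ++ w₁ , nt t f₁ , sym (concatMap-++ (h s) w₀ w₁)
  lift-sound s (inj₂ t ∷ β) f with forest-split (map inj₂ (h s t)) f
  ... | _ , _ , refl , f₁ , f₂ with terminals⁻ (h s t) f₁ | lift-sound s β f₂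
  ...   | refl | w₁ , g₂ , refl = t ∷ w₁ , tm t g₂ , refl

  focus-sound : ∀ {X φ w} → Focus X φ → Forest Meaning φ w →
                MarkedImage a hˡ m hʳ (Forest (Tree Rule) (X ∷ [])) w
  focus-sound (descend B) f with single⁻ f
  ... | u , v , t , e = u , v , single t , e
  focus-sound hit f = [] , [] , tm a [] , trans (terminals⁻ m f) (sym (++-identityʳ m))

  meaning-closed : ∀ {A β w} → MRule A β → Forest Meaning β w → Meaning A w
  meaning-closed (unmarked s r) f with lift-sound s _ f
  ... | w₀ , f₀ , e = w₀ , node r f₀ , e
  meaning-closed (marked pre post {φ} fc r) f with forest-split (lift left pre) f
  ... | _ , _ , refl , f₁ , f₂₃ with forest-split φ f₂₃
  ... | _ , _ , refl , f₂ , f₃ with lift-sound left pre f₁ | focus-sound fc f₂ | lift-sound right post f₃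
  ... | p , g₁ , refl | u , v , g₂ , refl | q , g₃ , refl =
    p ++ u , v ++ q ,
    node r (subst (Forest _ _) (regroup p u (a ∷ []) v q) (forest-++ g₁ (forest-++ g₂ g₃))) ,
    image-regroup p u v q

  side-complete : ∀ s {A w} → Tree Rule A w → Tree MRule (side s A) (concatMap (h s) w)
  lift-complete : ∀ s {β w} → Forest (Tree Rule) β w →
                  Forest (Tree MRule) (lift s β) (concatMap (h s) w)

  side-complete s (node r f) = node (unmarked s r) (lift-complete s f)
  lift-complete s [] = []
  lift-complete s (tm t f) = forest-++ (terminals (h s t)) (lift-complete s f)
  lift-complete s (nt {u = u} {w = w} t f) =
    subst (Forest _ _) (sym (concatMap-++ (h s) u w)) (nt (side-complete s t) (lift-complete s f))

  data Focused (β : List (N ⊎ T)) (u v : List T) : Set where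
    focused : ∀ pre {X} post {φ} → β ≡ pre ++ X ∷ post → Focus X φ →
              Forest (Tree MRule) (lift left pre ++ φ ++ lift right post)
                     (concatMap hˡ u ++ m ++ concatMap hʳ v) →
              Focused β u v

  focus-complete : ∀ {A} u v {w} → Tree Rule A w → w ≡ u ++ a ∷ v →
                   Tree MRule (focus A) (concatMap hˡ u ++ m ++ concatMap hʳ v)
  locate : ∀ u v {β w} → Forest (Tree Rule) β w → w ≡ u ++ a ∷ v → Focused β u v

  focus-complete u v (node r f) e with locate u v f e
  ... | focused pre post refl fc g = node (marked pre post fc r) g

  locate [] v [] ()
  locate (_ ∷ _) v [] ()
  locate [] v (tm t f) refl = focused [] _ refl hit (forest-++ (terminals m) (lift-complete right f))
  locate (t ∷ u) v (tm t f) refl with locate u v f refl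
  ... | focused pre post refl fc g =
    focused (inj₂ t ∷ pre) post refl fc
      (subst₂ (Forest _) (sym (++-assoc (map inj₂ (hˡ t)) (lift left pre) _)) (sym (++-assoc (hˡ t) _ _))
        (forest-++ (terminals (hˡ t)) g))
  locate u v (nt {u = w₁} {w = w₂} t f) e with split-at-letter w₁ u e
  ... | inj₁ (v₁ , refl , refl) =
    focused [] _ refl (descend _)
      (subst (Forest _ _) (image-regroup [] u v₁ w₂) (nt (focus-complete u v₁ t refl) (lift-complete right f)))
  ... | inj₂ (u₂ , refl , e₂) with locate u₂ v f e₂
  ...   | focused pre post refl fc g =
    focused (inj₁ _ ∷ pre) post refl fc
      (subst (Forest _ _) (image-prepend w₁ u₂ v) (nt (side-complete left t) g))

  markedGrammar : Grammar T
  markedGrammar = record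
    { N = Node ; finite = finite-⊎ (finite-× finite-Side finite) finite ; start = focus start
    ; Rule = MRule ; rules = markedRules ; listed = mk⇔ listed-to listed-from }

  markedGrammar-language : MarkedImage a hˡ m hʳ (language g) ≐ language markedGrammar
  markedGrammar-language w =
    (λ { (u , v , t , refl) → focus-complete u v t refl }) , tree-ind Meaning meaning-closed

MarkedImage-resp : {T : Set} {a : T} {hˡ hʳ : T → List T} {m : List T} {L L′ : Language T} →
                   L ≐ L′ → MarkedImage a hˡ m hʳ L ≐ MarkedImage a hˡ m hʳ L′
MarkedImage-resp e w = (λ { (u , v , l , p) → u , v , proj₁ (e _) l , p })
                     , (λ { (u , v , l , p) → u , v , proj₂ (e _) l , p })

markedImage-CF : {T : Set} → DecidableEquality T → (a : T) (hˡ : T → List T) (m : List T)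
                 (hʳ : T → List T) {L : Language T} →
                 IsContextFree L → IsContextFree (MarkedImage a hˡ m hʳ L)
markedImage-CF _≟ᵀ_ a hˡ m hʳ cf with grammar-of cf
... | g , e = context-free markedGrammar (≐-trans (MarkedImage-resp e) markedGrammar-language)
  where open Marking _≟ᵀ_ g a hˡ m hʳ

keepIf : {T : Set} → Bool → List T → List T
keepIf true u = u
keepIf false _ = []

select : {T : Set} → Bool → T → List T
select b t = keepIf b [ t ]

select-image : {T : Set} (b : Bool) (u : List T) → concatMap (select b) u ≡ keepIf b u
select-image true u = concatMap-pure u
select-image false [] = refl
select-image false (_ ∷ u) = select-image false u

Cut : {T : Set} → Bool → Bool → Bool → T → Language T → Language T
Cut b e f a = MarkedImage a (select b) (keepIf e [ a ]) (select f)

cut-intro : {T : Set} {b e f : Bool} (a : T) (L : Language T) (u v : List T) →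
            L (u ++ a ∷ v) → Cut b e f a L (keepIf b u ++ keepIf e [ a ] ++ keepIf f v)
cut-intro {b = b} {e} {f} a L u v l =
  u , v , l , sym (cong₂ (λ x y → x ++ keepIf e [ a ] ++ y) (select-image b u) (select-image f v))

cut-elim : {T : Set} {b e f : Bool} (a : T) (L : Language T) {w : List T} → Cut b e f a L w →
           ∃₂ λ u v → L (u ++ a ∷ v) × w ≡ keepIf b u ++ keepIf e [ a ] ++ keepIf f v
cut-elim {b = b} {e} {f} a L (u , v , l , p) =
  u , v , l , trans p (cong₂ (λ x y → x ++ keepIf e [ a ] ++ y) (select-image b u) (select-image f v))

-- Recombinations at the letter a whose left part comes from L and whose
-- right part comes from L or L′: given u a v ∈ L and u′ a v′ ∈ L′, the
-- words u a v (kept whole, L′ only witnessing a) and u a v′.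
Recombine : {T : Set} → T → Language T → Language T → Language T
Recombine a L L′ = (Cut true true true a L · Cut false false false a L′)
                 ∪ (Cut true true false a L · Cut false false true a L′)

recombine-intro : {T : Set} {a : T} {L L′ : Language T} {u v u′ v′ w : List T} →
  L (u ++ a ∷ v) → L′ (u′ ++ a ∷ v′) → (w ≡ u ++ a ∷ v) ⊎ (w ≡ u ++ a ∷ v′) → Recombine a L L′ w
recombine-intro {a = a} {L} {L′} {u} {v} {u′} {v′} l l′ (inj₁ p) =
  inj₁ (_ , _ , trans p (sym (++-identityʳ _)) , cut-intro a L u v l , cut-intro a L′ u′ v′ l′)
recombine-intro {a = a} {L} {L′} {u} {v} {u′} {v′} l l′ (inj₂ p) =
  inj₂ (_ , _ , trans p (sym (++-assoc u (a ∷ []) v′)) , cut-intro a L u v l , cut-intro a L′ u′ v′ l′)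

recombine-elim : {T : Set} {a : T} {L L′ : Language T} {w : List T} → Recombine a L L′ w →
  ∃₂ λ u v → ∃₂ λ u′ v′ → L (u ++ a ∷ v) × L′ (u′ ++ a ∷ v′) × ((w ≡ u ++ a ∷ v) ⊎ (w ≡ u ++ a ∷ v′))
recombine-elim {a = a} {L} {L′} (inj₁ (_ , _ , refl , c , c′)) with cut-elim a L c | cut-elim a L′ c′
... | u , v , l , refl | u′ , v′ , l′ , refl = u , v , u′ , v′ , l , l′ , inj₁ (++-identityʳ _)
recombine-elim {a = a} {L} {L′} (inj₂ (_ , _ , refl , c , c′)) with cut-elim a L c | cut-elim a L′ c′
... | u , v , l , refl | u′ , v′ , l′ , refl = u , v , u′ , v′ , l , l′ , inj₂ (++-assoc u (a ∷ []) v′)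

recombine-CF : {T : Set} → DecidableEquality T → (a : T) {L L′ : Language T} →
  IsContextFree L → IsContextFree L′ → IsContextFree (Recombine a L L′)
recombine-CF _≟ᵀ_ a cf cf′ = ∪-CF (·-CF (cut cf) (cut cf′)) (·-CF (cut cf) (cut cf′))
  where
  cut : ∀ {b e f L} → IsContextFree L → IsContextFree (Cut b e f a L)
  cut {b} {e} {f} = markedImage-CF _≟ᵀ_ a (select b) (keepIf e [ a ]) (select f)

-- A common factor x = a x′ may be shortened to its first letter a, so GSA
-- is the union over letters a of the recombinations at a.
GSA-by-letter : {T : Set} (L₁ L₂ : Language T) →
  GSA L₁ L₂ ≐ (λ w → ∃ λ a → (Recombine a L₁ L₂ ∪ Recombine a L₂ L₁) w)
GSA-by-letter L₁ L₂ w = to , from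
  where
  to : GSA L₁ L₂ w → ∃ λ a → (Recombine a L₁ L₂ ∪ Recombine a L₂ L₁) w
  to (_ , _ , _ , _ , [] , x≢[] , _) = ⊥-elim (x≢[] refl)
  to (_ , _ , l₁ , l₂ , a ∷ _ , _ , _ , _ , _ , _ , refl , refl , c) with c
  ... | inj₁ p = a , inj₁ (recombine-intro {L = L₁} {L₂} l₁ l₂ (inj₁ p))
  ... | inj₂ (inj₁ p) = a , inj₂ (recombine-intro {L = L₂} {L₁} l₂ l₁ (inj₁ p))
  ... | inj₂ (inj₂ (inj₁ p)) = a , inj₁ (recombine-intro {L = L₁} {L₂} l₁ l₂ (inj₂ p))
  ... | inj₂ (inj₂ (inj₂ p)) = a , inj₂ (recombine-intro {L = L₂} {L₁} l₂ l₁ (inj₂ p))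

  from : (∃ λ a → (Recombine a L₁ L₂ ∪ Recombine a L₂ L₁) w) → GSA L₁ L₂ w
  from (a , inj₁ r) with recombine-elim {L = L₁} {L₂} r
  ... | u , v , u′ , v′ , l , l′ , c =
    _ , _ , l , l′ , a ∷ [] , (λ ()) , u , v , u′ , v′ , refl , refl ,
    [ inj₁ , inj₂ ∘ inj₂ ∘ inj₁ ]′ c
  from (a , inj₂ r) with recombine-elim {L = L₂} {L₁} r
  ... | u , v , u′ , v′ , l , l′ , c =
    _ , _ , l′ , l , a ∷ [] , (λ ()) , u′ , v′ , u , v , refl , refl ,
    [ inj₂ ∘ inj₁ , inj₂ ∘ inj₂ ∘ inj₂ ]′ c

theorem8 : (k : ℕ) (L₁ L₂ : Language (Fin k)) →
    IsContextFree L₁ → IsContextFree L₂ → IsContextFree (GSA L₁ L₂)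
theorem8 k L₁ L₂ cf₁ cf₂ =
  IsCF-resp (≐-sym (GSA-by-letter L₁ L₂))
    (⋃-CF k (λ a → Recombine a L₁ L₂ ∪ Recombine a L₂ L₁)
      λ a → ∪-CF (recombine-CF _≟_ a cf₁ cf₂) (recombine-CF _≟_ a cf₂ cf₁))
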